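{- Let $s$ be a string of length $n$ and let $4\le\tau\le\tau'\le n/2$. Every $\tau$-partitioning set of $s$ is also $\tau'$-partitioning.
   Context: Notation: $s[i..j]=s[i]\cdots s[j]$; $[i..j]=\{k\in\mathbb{Z}:i\le k\le j\}$, $[i..j)=[i..j]\setminus\{j\}$, $(i..j)=[i..j]\setminus\{i,j\}$. A number $p\in[1..|t|]$ is a period of a string $t$ if $t[i]=t[i-p]$ for all $i\in[p..|t|)$. For $\tau\in[4..n/2]$, a set $S\subseteq[0..n)$ is $\tau$-partitioning if: (a) whenever $s[i-\tau..i+\tau]=s[j-\tau..j+\tau]$ for $i,j\in[\tau..n-\tau)$, we have $i\in S$ iff $j\in S$; (b) whenever $s[i..i+\ell]=s[j..j+\ell]$ for $i,j\in S$ and some $\ell\ge0$, then for each $d\in[0..\ell-\tau)$, $i+d\in S$ iff $j+d\in S$; (c) whenever $i,j\in S$, $j-i>\tau$ and $(i..j)\cap S=\emptyset$, the string $s[i..j]$ has a period at most $\tau/4$. -}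

module Defs where

open import Level using (Level; 0ℓ)
open import Data.Nat using (ℕ; zero; suc; _+_; _*_; _∸_; _≤_; _<_)
open import Data.Fin using (Fin; fromℕ<)
open import Data.Vec using (Vec; lookup)
open import Data.Product using (Σ; ∃; _×_)
open import Data.Empty using (⊥)
open import Relation.Binary.PropositionalEquality using (_≡_)

-- A string of length n over an alphabet A is a  Vec A n ; positions are 0-based.

CharEq : {A : Set} {n : ℕ} → Vec A n → ℕ → ℕ → Set
CharEq {n = n} s i j =
  Σ (i < n) λ p → Σ (j < n) λ q → lookup s (fromℕ< p) ≡ lookup s (fromℕ< q)

FragEq : {A : Set} {n : ℕ} → Vec A n → ℕ → ℕ → ℕ → Set
FragEq s i j ℓ = ∀ k → k ≤ ℓ → CharEq s (i + k) (j + k)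

HasPeriod : {A : Set} {n : ℕ} → Vec A n → ℕ → ℕ → ℕ → Set
HasPeriod s i j p =
  1 ≤ p × p ≤ suc (j ∸ i) ×
  (∀ k → p ≤ k → k < suc (j ∸ i) → CharEq s (i + k) (i + k ∸ p))

-- S ⊆ [0..n) is τ-partitioning for s; "period at most τ/4" is written 4·p ≤ τ
IsPartitioning : {A : Set} {n : ℕ} → Vec A n → ℕ → (ℕ → Set) → Set
IsPartitioning {n = n} s τ S =
  (∀ i → S i → i < n) ×
  (∀ i j → τ ≤ i → i < n ∸ τ → τ ≤ j → j < n ∸ τ →
     FragEq s (i ∸ τ) (j ∸ τ) (2 * τ) → (S i → S j) × (S j → S i)) ×
  (∀ i j ℓ → S i → S j → FragEq s i j ℓ →
     ∀ d → d < ℓ ∸ τ → (S (i + d) → S (j + d)) × (S (j + d) → S (i + d))) ×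
  (∀ i j → S i → S j → i + τ < j → (∀ k → i < k → k < j → S k → ⊥) →
     ∃ λ p → HasPeriod s i j p × 4 * p ≤ τ)

{-# OPTIONS --safe #-}
-- Each of the three conditions only gets weaker as τ grows: in (a) a longer
-- context s[i-τ′..i+τ′] contains the shorter one s[i-τ..i+τ]; in (b) the range
-- d < ℓ - τ′ lies inside d < ℓ - τ; in (c) a gap longer than τ′ is longer than τ,
-- and a period at most τ/4 is at most τ′/4.
module Submission where

open import Defs
open import Data.Nat using (ℕ; _≤_; _*_; _+_; _∸_; _<_)
open import Data.Nat.Properties
open import Data.Vec using (Vec)
open import Data.Product using (∃; _×_; _,_)
open import Data.Empty using (⊥)
open import Relation.Binary.PropositionalEquality

module _ {A : Set} {n : ℕ} (s : Vec A n) where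

  FragEq-suffix : ∀ {a b L L′} m → FragEq s a b L → m + L′ ≤ L →
                  FragEq s (a + m) (b + m) L′
  FragEq-suffix {a} {b} m eq m+L′≤L k k≤L′ =
    subst₂ (CharEq s) (sym (+-assoc a m k)) (sym (+-assoc b m k))
      (eq (m + k) (≤-trans (+-monoʳ-≤ m k≤L′) m+L′≤L))

  ContextConsistent : ℕ → (ℕ → Set) → Set
  ContextConsistent τ S =
    ∀ i j → τ ≤ i → i < n ∸ τ → τ ≤ j → j < n ∸ τ →
      FragEq s (i ∸ τ) (j ∸ τ) (2 * τ) → (S i → S j) × (S j → S i)

  FragmentConsistent : ℕ → (ℕ → Set) → Set
  FragmentConsistent τ S =
    ∀ i j ℓ → S i → S j → FragEq s i j ℓ →
      ∀ d → d < ℓ ∸ τ → (S (i + d) → S (j + d)) × (S (j + d) → S (i + d))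

  LongGapsPeriodic : ℕ → (ℕ → Set) → Set
  LongGapsPeriodic τ S =
    ∀ i j → S i → S j → i + τ < j → (∀ k → i < k → k < j → S k → ⊥) →
      ∃ λ p → HasPeriod s i j p × 4 * p ≤ τ

  private
    ∸-split : ∀ {t t′ i} → t ≤ t′ → t′ ≤ i → i ∸ t ≡ (i ∸ t′) + (t′ ∸ t)
    ∸-split {t} {t′} {i} t≤t′ t′≤i = begin
      i ∸ t                ≡⟨ cong (_∸ t) (sym (m∸n+n≡m t′≤i)) ⟩
      (i ∸ t′) + t′ ∸ t    ≡⟨ +-∸-assoc (i ∸ t′) t≤t′ ⟩
      (i ∸ t′) + (t′ ∸ t)  ∎
      where open ≡-Reasoning

    inner-context-fits : ∀ {t t′} → t ≤ t′ → (t′ ∸ t) + 2 * t ≤ 2 * t′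
    inner-context-fits {t} {t′} t≤t′ = begin
      (t′ ∸ t) + (t + (t + 0))  ≡⟨ sym (+-assoc (t′ ∸ t) t (t + 0)) ⟩
      (t′ ∸ t) + t + (t + 0)    ≡⟨ cong (_+ (t + 0)) (m∸n+n≡m t≤t′) ⟩
      t′ + (t + 0)              ≤⟨ +-monoʳ-≤ t′ (+-monoˡ-≤ 0 t≤t′) ⟩
      t′ + (t′ + 0)             ∎
      where open ≤-Reasoning

    context-at : ∀ {t t′ i j} → t ≤ t′ → t′ ≤ i → t′ ≤ j →
                 FragEq s (i ∸ t′) (j ∸ t′) (2 * t′) →
                 FragEq s (i ∸ t) (j ∸ t) (2 * t)
    context-at {t} {t′} t≤t′ t′≤i t′≤j eq =
      subst₂ (λ a b → FragEq s a b (2 * t))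
        (sym (∸-split t≤t′ t′≤i)) (sym (∸-split t≤t′ t′≤j))
        (FragEq-suffix (t′ ∸ t) eq (inner-context-fits t≤t′))

  ContextConsistent-mono : ∀ {τ τ′ S} → τ ≤ τ′ →
                           ContextConsistent τ S → ContextConsistent τ′ S
  ContextConsistent-mono τ≤τ′ consistent i j τ′≤i i<n∸τ′ τ′≤j j<n∸τ′ eq =
    consistent i j (≤-trans τ≤τ′ τ′≤i) (<-≤-trans i<n∸τ′ (∸-monoʳ-≤ n τ≤τ′))
                   (≤-trans τ≤τ′ τ′≤j) (<-≤-trans j<n∸τ′ (∸-monoʳ-≤ n τ≤τ′))
                   (context-at τ≤τ′ τ′≤i τ′≤j eq)

  FragmentConsistent-mono : ∀ {τ τ′ S} → τ ≤ τ′ →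
                            FragmentConsistent τ S → FragmentConsistent τ′ S
  FragmentConsistent-mono τ≤τ′ consistent i j ℓ si sj eq d d<ℓ∸τ′ =
    consistent i j ℓ si sj eq d (<-≤-trans d<ℓ∸τ′ (∸-monoʳ-≤ ℓ τ≤τ′))

  LongGapsPeriodic-mono : ∀ {τ τ′ S} → τ ≤ τ′ →
                          LongGapsPeriodic τ S → LongGapsPeriodic τ′ S
  LongGapsPeriodic-mono τ≤τ′ periodic i j si sj i+τ′<j gap
    with periodic i j si sj (≤-<-trans (+-monoʳ-≤ i τ≤τ′) i+τ′<j) gap
  ... | p , period , 4p≤τ = p , period , ≤-trans 4p≤τ τ≤τ′

-- The bounds 4 ≤ τ and 2τ′ ≤ n only keep τ′ in the paper's range; monotonicity does not need them.
lemma2 : {A : Set} (n : ℕ) (s : Vec A n) (τ τ′ : ℕ) →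
    4 ≤ τ → τ ≤ τ′ → 2 * τ′ ≤ n →
    (S : ℕ → Set) → IsPartitioning s τ S → IsPartitioning s τ′ S
lemma2 n s τ τ′ _ τ≤τ′ _ S (inside , context , fragment , gaps) =
    inside
  , ContextConsistent-mono s τ≤τ′ context
  , FragmentConsistent-mono s τ≤τ′ fragment
  , LongGapsPeriodic-mono s τ≤τ′ gaps
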